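{- Let $n>1$ be an integer and let $S=\{d\in\mathbb N: d=\gcd(\gcd(a,b),n)$ for some elements $a,b\in\mathbb Z_n$ incomparable with respect to $\leq\}$. Then $(\mathbb Z_n,\leq)$ is a lattice if and only if for every $d\in S$ the coset $(n/d)+1$ has a smallest element with respect to $\leq$.
   Context: On $\mathbb Z_n$ define the partial order $\leq$ by: $a\leq b$ iff $a=b$ or $a\equiv ab\pmod n$. For $x\in\mathbb Z_n$, $(x)$ denotes the ideal of $\mathbb Z_n$ generated by $x$, and $(x)+1=\{y+1: y\in(x)\}$. -}

module Defs where

open import Data.Nat using (ℕ; zero; suc; _+_; _*_; _/_; _%_; NonZero)
open import Data.Nat.GCD using (gcd)
open import Data.Fin using (Fin; toℕ)
open import Data.Product using (Σ; ∃; _×_)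
open import Data.Sum using (_⊎_)
open import Relation.Nullary using (¬_)
open import Relation.Binary.PropositionalEquality using (_≡_)

-- Elements of ℤ_n are represented by Fin n (residues 0,…,n-1).
module _ (n : ℕ) .{{_ : NonZero n}} where

  _≼_ : Fin n → Fin n → Set
  a ≼ b = a ≡ b ⊎ toℕ a ≡ (toℕ a * toℕ b) % n

  Incomparable : Fin n → Fin n → Set
  Incomparable a b = ¬ (a ≼ b) × ¬ (b ≼ a)

  IsJoin : Fin n → Fin n → Fin n → Set
  IsJoin a b j = (a ≼ j) × (b ≼ j) × (∀ u → a ≼ u → b ≼ u → j ≼ u)

  IsMeet : Fin n → Fin n → Fin n → Set
  IsMeet a b m = (m ≼ a) × (m ≼ b) × (∀ l → l ≼ a → l ≼ b → l ≼ m)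

  IsLattice : Set
  IsLattice = ∀ a b → (∃ λ j → IsJoin a b j) × (∃ λ m → IsMeet a b m)

  InS : ℕ → Set
  InS d = Σ (Fin n) λ a → Σ (Fin n) λ b → Incomparable a b × d ≡ gcd (gcd (toℕ a) (toℕ b)) n

  InIdeal : ℕ → Fin n → Set
  InIdeal x y = ∃ λ k → toℕ y ≡ (k * x) % n

  InCoset : ℕ → Fin n → Set
  InCoset x z = Σ (Fin n) λ y → InIdeal x y × toℕ z ≡ (toℕ y + 1) % n

  HasSmallest : ℕ → Set
  HasSmallest x = Σ (Fin n) λ s → InCoset x s × (∀ z → InCoset x z → s ≼ z)

-- natural-number quotient n/d; only used with d = gcd(…, n) ≠ 0 (as n ≠ 0),
-- the zero case is a dummy to avoid carrying a NonZero instance.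
quot : ℕ → ℕ → ℕ
quot n zero = 0
quot n (suc d) = n / suc d

-- For incomparable a, b, an upper bound u ≠ a, b is exactly a solution of
-- a(u − 1) ≡ b(u − 1) ≡ 0 (mod n), i.e. of n ∣ d(u − 1) with d = gcd(a, b, n),
-- i.e. an element of the coset (n/d) + 1. Hence a and b have a join iff that
-- coset has a smallest element. Comparable pairs always have a join, and a
-- finite poset with a least element (here 0) and all binary joins has all
-- meets: the meet of a and b is the join of their lower bounds.
module Submission where

open import Defs
open import Data.Nat using (ℕ; _<_; NonZero)
open import Function.Bundles using (_⇔_)

open import Data.Nat using (zero; suc; _+_; _*_; _/_; _%_; ≢-nonZero; ≢-nonZero⁻¹)
open import Data.Nat.Properties using (+-assoc; +-comm; *-comm; *-assoc; *-suc; *-distribˡ-+)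
open import Data.Nat.DivMod
open import Data.Nat.Divisibility
open import Data.Nat.GCD using (gcd; gcd[m,n]∣m; gcd[m,n]∣n; gcd-greatest; c*gcd[m,n]≡gcd[cm,cn]; gcd[m,n]≢0)
open import Data.Fin as Fin using (Fin; toℕ; fromℕ<)
open import Data.Fin.Properties using (toℕ<n; toℕ-fromℕ<)
open import Data.Product using (∃; _×_; _,_; proj₁; proj₂)
open import Data.Product.Function.NonDependent.Propositional using (_×-⇔_)
open import Data.Sum using (inj₁; inj₂)
open import Data.Empty using (⊥-elim)
open import Data.List using (List; []; _∷_; filter; allFin)
open import Data.List.Relation.Unary.All as All using (All; []; _∷_)
open import Data.List.Relation.Unary.All.Properties using (all-filter)
open import Data.List.Relation.Unary.Any using (here; there)
open import Data.List.Membership.Propositional using (_∈_)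
open import Data.List.Membership.Propositional.Properties using (∈-filter⁺; ∈-allFin)
open import Relation.Nullary using (Dec; yes; no)
open import Relation.Nullary.Decidable using (_⊎-dec_; _×-dec_)
open import Relation.Binary.PropositionalEquality using (_≡_; refl; sym; trans; cong; subst; module ≡-Reasoning)
open import Function.Bundles using (mk⇔; Equivalence)
open import Function.Properties.Equivalence as ⇔ using ()
open import Function.Related.Propositional using (module EquationalReasoning; equivalence)

module JoinsToMeets
  {A : Set} (_≤_ : A → A → Set)
  (≤-trans : ∀ {x y z} → x ≤ y → y ≤ z → x ≤ z)
  (_≤?_ : ∀ x y → Dec (x ≤ y))
  (⊥ : A) (⊥-least : ∀ x → ⊥ ≤ x)
  (elements : List A) (∈-elements : ∀ x → x ∈ elements)
  (join : ∀ a b → ∃ λ j → a ≤ j × b ≤ j × (∀ u → a ≤ u → b ≤ u → j ≤ u))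
  where

  _∨_ : A → A → A
  a ∨ b = proj₁ (join a b)

  ⋁ : List A → A
  ⋁ []       = ⊥
  ⋁ (x ∷ xs) = x ∨ ⋁ xs

  ≤-⋁ : ∀ {x xs} → x ∈ xs → x ≤ ⋁ xs
  ≤-⋁ {xs = y ∷ ys} (here refl) = proj₁ (proj₂ (join y (⋁ ys)))
  ≤-⋁ {xs = y ∷ ys} (there x∈ys) = ≤-trans (≤-⋁ x∈ys) (proj₁ (proj₂ (proj₂ (join y (⋁ ys)))))

  ⋁-least : ∀ {xs c} → All (_≤ c) xs → ⋁ xs ≤ c
  ⋁-least {c = c} []                = ⊥-least c
  ⋁-least {y ∷ ys} {c} (y≤c ∷ ys≤c) = proj₂ (proj₂ (proj₂ (join y (⋁ ys)))) c y≤c (⋁-least ys≤c)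

  meet : ∀ a b → ∃ λ m → m ≤ a × m ≤ b × (∀ l → l ≤ a → l ≤ b → l ≤ m)
  meet a b =
    ⋁ lowerBounds ,
    ⋁-least (All.map proj₁ (all-filter isLowerBound? elements)) ,
    ⋁-least (All.map proj₂ (all-filter isLowerBound? elements)) ,
    λ l l≤a l≤b → ≤-⋁ (∈-filter⁺ isLowerBound? (∈-elements l) (l≤a , l≤b))
    where
    isLowerBound? : ∀ x → Dec (x ≤ a × x ≤ b)
    isLowerBound? x = (x ≤? a) ×-dec (x ≤? b)

    lowerBounds : List A
    lowerBounds = filter isLowerBound? elements

[m%o+n]%o≡[m+n]%o : ∀ x y n .{{_ : NonZero n}} → (x % n + y) % n ≡ (x + y) % n
[m%o+n]%o≡[m+n]%o x y n = begin
  (x % n + y) % n           ≡⟨ %-distribˡ-+ (x % n) y n ⟩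
  (x % n % n + y % n) % n   ≡⟨ cong (λ v → (v + y % n) % n) (m%n%n≡m%n x n) ⟩
  (x % n + y % n) % n       ≡⟨ %-distribˡ-+ x y n ⟨
  (x + y) % n               ∎
  where open ≡-Reasoning

[m*[n%o]]%o≡[m*n]%o : ∀ x y n .{{_ : NonZero n}} → (x * (y % n)) % n ≡ (x * y) % n
[m*[n%o]]%o≡[m*n]%o x y n = begin
  (x * (y % n)) % n         ≡⟨ %-distribˡ-* x (y % n) n ⟩
  (x % n * (y % n % n)) % n ≡⟨ cong (λ v → (x % n * v) % n) (m%n%n≡m%n y n) ⟩
  (x % n * (y % n)) % n     ≡⟨ %-distribˡ-* x y n ⟨
  (x * y) % n               ∎
  where open ≡-Reasoning

a≡ab⇒b≡bc⇒a≡ac : ∀ {a b c} n .{{_ : NonZero n}} →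
  a ≡ (a * b) % n → b ≡ (b * c) % n → a ≡ (a * c) % n
a≡ab⇒b≡bc⇒a≡ac {a} {b} {c} n a≡ab b≡bc = begin
  a                       ≡⟨ a≡ab ⟩
  (a * b) % n             ≡⟨ cong (λ v → (a * v) % n) b≡bc ⟩
  (a * ((b * c) % n)) % n ≡⟨ [m*[n%o]]%o≡[m*n]%o a (b * c) n ⟩
  (a * (b * c)) % n       ≡⟨ cong (_% n) (trans (sym (*-assoc a b c)) (*-comm (a * b) c)) ⟩
  (c * (a * b)) % n       ≡⟨ [m*[n%o]]%o≡[m*n]%o c (a * b) n ⟨
  (c * ((a * b) % n)) % n ≡⟨ cong (λ v → (c * v) % n) a≡ab ⟨
  (c * a) % n             ≡⟨ cong (_% n) (*-comm c a) ⟩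
  (a * c) % n             ∎
  where open ≡-Reasoning

-- Modulo n = 1 + m, adding m is subtracting 1.

[[x+1]%n+m]%n≡x%n : ∀ m x → ((x + 1) % suc m + m) % suc m ≡ x % suc m
[[x+1]%n+m]%n≡x%n m x = begin
  ((x + 1) % suc m + m) % suc m ≡⟨ [m%o+n]%o≡[m+n]%o (x + 1) m (suc m) ⟩
  (x + 1 + m) % suc m           ≡⟨ cong (_% suc m) (+-assoc x 1 m) ⟩
  (x + suc m) % suc m           ≡⟨ [m+n]%n≡m%n x (suc m) ⟩
  x % suc m                     ∎
  where open ≡-Reasoning

[[x+m]%n+1]%n≡x%n : ∀ m x → ((x + m) % suc m + 1) % suc m ≡ x % suc m
[[x+m]%n+1]%n≡x%n m x = begin
  ((x + m) % suc m + 1) % suc m ≡⟨ [m%o+n]%o≡[m+n]%o (x + m) 1 (suc m) ⟩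
  (x + m + 1) % suc m           ≡⟨ cong (_% suc m) (trans (+-assoc x m 1) (cong (x +_) (+-comm m 1))) ⟩
  (x + suc m) % suc m           ≡⟨ [m+n]%n≡m%n x (suc m) ⟩
  x % suc m                     ∎
  where open ≡-Reasoning

a≡au⇔n∣[u-1]a : ∀ m {a} u → a < suc m → a ≡ (a * u) % suc m ⇔ suc m ∣ (u + m) * a
a≡au⇔n∣[u-1]a m {a} u a<n = mk⇔ to from
  where
  open ≡-Reasoning
  n = suc m

  [u+m]a≡au+am : (u + m) * a ≡ a * u + a * m
  [u+m]a≡au+am = trans (*-comm (u + m) a) (*-distribˡ-+ a u m)

  to : a ≡ (a * u) % n → n ∣ (u + m) * a
  to a≡au = m%n≡0⇒n∣m _ n (begin
    ((u + m) * a) % n       ≡⟨ cong (_% n) [u+m]a≡au+am ⟩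
    (a * u + a * m) % n     ≡⟨ [m%o+n]%o≡[m+n]%o (a * u) (a * m) n ⟨
    ((a * u) % n + a * m) % n ≡⟨ cong (λ v → (v + a * m) % n) a≡au ⟨
    (a + a * m) % n         ≡⟨ cong (_% n) (*-suc a m) ⟨
    (a * n) % n             ≡⟨ m*n%n≡0 a n ⟩
    0                       ∎)

  from : n ∣ (u + m) * a → a ≡ (a * u) % n
  from n∣[u-1]a = begin
    a                       ≡⟨ m<n⇒m%n≡m a<n ⟨
    a % n                   ≡⟨ %-remove-+ˡ a n∣[u-1]a ⟨
    ((u + m) * a + a) % n   ≡⟨ cong (λ v → (v + a) % n) [u+m]a≡au+am ⟩
    (a * u + a * m + a) % n ≡⟨ cong (_% n) (+-assoc (a * u) (a * m) a) ⟩
    (a * u + (a * m + a)) % n ≡⟨ cong (λ v → (a * u + v) % n) (trans (+-comm (a * m) a) (sym (*-suc a m))) ⟩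
    (a * u + a * n) % n     ≡⟨ [m+kn]%n≡m%n (a * u) a n ⟩
    (a * u) % n             ∎

n∣t*gcd⇔n∣t*x×n∣t*y : ∀ {n} t x y → n ∣ t * gcd x y ⇔ (n ∣ t * x × n ∣ t * y)
n∣t*gcd⇔n∣t*x×n∣t*y {n} t x y = mk⇔
  (λ n∣t*g → ∣-trans n∣t*g (*-monoʳ-∣ t (gcd[m,n]∣m x y)) , ∣-trans n∣t*g (*-monoʳ-∣ t (gcd[m,n]∣n x y)))
  (λ (n∣tx , n∣ty) → subst (n ∣_) (sym (c*gcd[m,n]≡gcd[cm,cn] t x y)) (gcd-greatest n∣tx n∣ty))

n∣t*x⇔n/gcd[x,n]∣t : ∀ {n} t x .{{_ : NonZero (gcd x n)}} → n ∣ t * x ⇔ n / gcd x n ∣ t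
n∣t*x⇔n/gcd[x,n]∣t {n} t x = mk⇔
  (λ n∣tx → m∣n*o⇒m/n∣o (gcd[m,n]∣n x n) (Equivalence.from (n∣t*gcd⇔n∣t*x×n∣t*y {n} t x n) (n∣tx , n∣m*n t)))
  (λ n/g∣t → ∣-trans (m/n∣o⇒m∣o*n (gcd[m,n]∣n x n) n/g∣t) (*-monoʳ-∣ t (gcd[m,n]∣m x n)))

InCoset⇔∣[u-1] : ∀ m {q} → q ∣ suc m → (u : Fin (suc m)) → InCoset (suc m) q u ⇔ q ∣ toℕ u + m
InCoset⇔∣[u-1] m {q} q∣n u = mk⇔ to from
  where
  n = suc m

  to : InCoset n q u → q ∣ toℕ u + m
  to (y , (k , y≡kq) , u≡y+1) = ∣n∣m%n⇒∣m q∣n (subst (q ∣_) (sym [u+m]%n≡y) q∣y)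
    where
    q∣y : q ∣ toℕ y
    q∣y = subst (q ∣_) (sym y≡kq) (%-presˡ-∣ (n∣m*n k) q∣n)
    [u+m]%n≡y : (toℕ u + m) % n ≡ toℕ y
    [u+m]%n≡y = trans (cong (λ v → (v + m) % n) u≡y+1)
                      (trans ([[x+1]%n+m]%n≡x%n m (toℕ y)) (m<n⇒m%n≡m (toℕ<n y)))

  from : q ∣ toℕ u + m → InCoset n q u
  from (divides k u+m≡kq) = y , (k , y≡kq) , u≡y+1
    where
    y : Fin n
    y = fromℕ< (m%n<n (toℕ u + m) n)
    y≡[u+m]%n : toℕ y ≡ (toℕ u + m) % n
    y≡[u+m]%n = toℕ-fromℕ< (m%n<n (toℕ u + m) n)
    y≡kq : toℕ y ≡ (k * q) % n
    y≡kq = trans y≡[u+m]%n (cong (_% n) u+m≡kq)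
    u≡y+1 : toℕ u ≡ (toℕ y + 1) % n
    u≡y+1 = sym (trans (cong (λ v → (v + 1) % n) y≡[u+m]%n)
                       (trans ([[x+m]%n+1]%n≡x%n m (toℕ u)) (m<n⇒m%n≡m (toℕ<n u))))

quot≡/ : ∀ n d .{{_ : NonZero d}} → quot n d ≡ n / d
quot≡/ n zero    = ⊥-elim (≢-nonZero⁻¹ zero refl)
quot≡/ n (suc d) = refl

gcd-nonZero : ∀ x n .{{_ : NonZero n}} → NonZero (gcd x n)
gcd-nonZero x n = ≢-nonZero (gcd[m,n]≢0 x n (inj₂ (≢-nonZero⁻¹ n)))

module Residues (m : ℕ) where
  n : ℕ
  n = suc m

  infix 4 _≼ₙ_ _≼?_
  _≼ₙ_ : Fin n → Fin n → Set
  _≼ₙ_ = _≼_ n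

  _≼?_ : ∀ a b → Dec (a ≼ₙ b)
  a ≼? b = (a Fin.≟ b) ⊎-dec (toℕ a Data.Nat.≟ (toℕ a * toℕ b) % n)

  ≼-trans : ∀ {a b c} → a ≼ₙ b → b ≼ₙ c → a ≼ₙ c
  ≼-trans (inj₁ refl) b≼c         = b≼c
  ≼-trans (inj₂ a≡ab) (inj₁ refl) = inj₂ a≡ab
  ≼-trans (inj₂ a≡ab) (inj₂ b≡bc) = inj₂ (a≡ab⇒b≡bc⇒a≡ac n a≡ab b≡bc)

  zero-least : ∀ a → Fin.zero ≼ₙ a
  zero-least _ = inj₂ refl

  upperBound⇔coset : ∀ {a b} → Incomparable n a b → ∀ u →
    (a ≼ₙ u × b ≼ₙ u) ⇔ InCoset n (quot n (gcd (gcd (toℕ a) (toℕ b)) n)) u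
  upperBound⇔coset {a} {b} (a⋠b , b⋠a) u = begin
    (a ≼ₙ u × b ≼ₙ u)                       ∼⟨ strict ⟩
    (A ≡ (A * U) % n × B ≡ (B * U) % n)     ∼⟨ a≡au⇔n∣[u-1]a m U (toℕ<n a) ×-⇔ a≡au⇔n∣[u-1]a m U (toℕ<n b) ⟩
    (n ∣ (U + m) * A × n ∣ (U + m) * B)     ∼⟨ ⇔.sym (n∣t*gcd⇔n∣t*x×n∣t*y (U + m) A B) ⟩
    n ∣ (U + m) * gcd A B                   ∼⟨ n∣t*x⇔n/gcd[x,n]∣t (U + m) (gcd A B) ⟩
    n / d ∣ U + m                           ∼⟨ ⇔.sym (InCoset⇔∣[u-1] m (m/n∣m (gcd[m,n]∣n (gcd A B) n)) u) ⟩
    InCoset n (n / d) u                     ≡⟨ cong (λ q → InCoset n q u) (quot≡/ n d) ⟨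
    InCoset n (quot n d) u                  ∎
    where
    open EquationalReasoning {k = equivalence}
    A = toℕ a
    B = toℕ b
    U = toℕ u
    d = gcd (gcd A B) n
    instance
      d≢0 : NonZero d
      d≢0 = gcd-nonZero (gcd A B) n

    -- An upper bound equal to a (or b) would make a and b comparable.
    strict : (a ≼ₙ u × b ≼ₙ u) ⇔ (A ≡ (A * U) % n × B ≡ (B * U) % n)
    strict = mk⇔ to λ (a≡au , b≡bu) → inj₂ a≡au , inj₂ b≡bu
      where
      to : a ≼ₙ u × b ≼ₙ u → A ≡ (A * U) % n × B ≡ (B * U) % n
      to (inj₁ refl , b≼a)        = ⊥-elim (b⋠a b≼a)
      to (inj₂ a≡ab , inj₁ refl)  = ⊥-elim (a⋠b (inj₂ a≡ab))
      to (inj₂ a≡au , inj₂ b≡bu) = a≡au , b≡bu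

  join⇔smallest : ∀ {a b} → Incomparable n a b →
    (∃ λ j → IsJoin n a b j) ⇔ HasSmallest n (quot n (gcd (gcd (toℕ a) (toℕ b)) n))
  join⇔smallest a∥b = mk⇔
    (λ (j , a≼j , b≼j , j-least) →
       j , to (a≼j , b≼j) , λ z z∈C → j-least z (proj₁ (from z∈C)) (proj₂ (from z∈C)))
    (λ (s , s∈C , s-smallest) →
       s , proj₁ (from s∈C) , proj₂ (from s∈C) , λ u a≼u b≼u → s-smallest u (to (a≼u , b≼u)))
    where
    to   = λ {u} → Equivalence.to (upperBound⇔coset a∥b u)
    from = λ {u} → Equivalence.from (upperBound⇔coset a∥b u)

  smallest-from-lattice : IsLattice n → ∀ d → InS n d → HasSmallest n (quot n d)
  smallest-from-lattice lattice _ (a , b , a∥b , refl) =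
    Equivalence.to (join⇔smallest a∥b) (proj₁ (lattice a b))

  module _ (smallest : ∀ d → InS n d → HasSmallest n (quot n d)) where

    join : ∀ a b → ∃ λ j → IsJoin n a b j
    join a b with a ≼? b | b ≼? a
    ... | yes a≼b | _       = b , a≼b , inj₁ refl , λ _ _ b≼u → b≼u
    ... | no _    | yes b≼a = a , inj₁ refl , b≼a , λ _ a≼u _ → a≼u
    ... | no a⋠b  | no b⋠a  =
      Equivalence.from (join⇔smallest (a⋠b , b⋠a)) (smallest _ (a , b , (a⋠b , b⋠a) , refl))

    lattice-from-smallest : IsLattice n
    lattice-from-smallest a b =
      join a b , JoinsToMeets.meet _≼ₙ_ ≼-trans _≼?_ Fin.zero zero-least (allFin n) ∈-allFin join a b

corollary3p2 : (n : ℕ) .{{_ : NonZero n}} → 1 < n →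
    IsLattice n ⇔ (∀ d → InS n d → HasSmallest n (quot n d))
corollary3p2 (suc m) _ = mk⇔ (smallest-from-lattice m) (lattice-from-smallest m)
  where open Residues
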